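{- Let $T$ be a rooted binary tree of depth at least $1$ and rank $r$, with leaves labelled by $0$ and $1$. Let $T_0,T_1$ be arbitrary rooted binary trees of ranks $r_0,r_1$. For $b\in\{0,1\}$, attach (a copy of) $T_b$ at each leaf of $T$ labelled $b$, obtaining a rooted binary tree $T'$ of rank $r'$. Then: (1) $r'\le r+\max\{r_0,r_1\}$; furthermore, if $T$ is a complete binary tree and $r_0=r_1$, then $r'=r+r_0$. (2) If every subtree of $T$ with more than one leaf has both a $0$-leaf and a $1$-leaf, then $r'\ge r+\max\{r_0,r_1\}-1$; if furthermore $T$ is a complete binary tree, this is an equality when $r_0\ne r_1$.
   Context: The rank of a rooted binary tree is the rank of its root, defined recursively: a leaf has rank $0$; an internal node whose two children have ranks $a,b$ has rank $a+1$ if $a=b$ and $\max\{a,b\}$ otherwise. A complete binary tree of depth $d$ is one in which all leaves are at depth $d$. -}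

module Defs where

open import Data.Nat using (ℕ; zero; suc; _⊔_; _≟_)
open import Data.Bool using (Bool; true; false)
open import Data.Unit using (⊤)
open import Data.Product using (_×_)
open import Data.Sum using (_⊎_)
open import Relation.Nullary using (yes; no)

data Tree : Set where
  leaf : Tree
  node : Tree → Tree → Tree

-- Rooted binary trees whose leaves are labelled by 0/1 (false = 0, true = 1).
data LTree : Set where
  lleaf : Bool → LTree
  lnode : LTree → LTree → LTree

rankNode : ℕ → ℕ → ℕ
rankNode a b with a ≟ b
... | yes _ = suc a
... | no  _ = a ⊔ b

rank : Tree → ℕ
rank leaf       = 0
rank (node l r) = rankNode (rank l) (rank r)

unlabel : LTree → Tree
unlabel (lleaf _)   = leaf
unlabel (lnode l r) = node (unlabel l) (unlabel r)

lrank : LTree → ℕ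
lrank t = rank (unlabel t)

attach : LTree → Tree → Tree → Tree
attach (lleaf false) t₀ t₁ = t₀
attach (lleaf true)  t₀ t₁ = t₁
attach (lnode l r)   t₀ t₁ = node (attach l t₀ t₁) (attach r t₀ t₁)

DepthPos : LTree → Set
DepthPos (lleaf _)   = Data.Empty.⊥ where import Data.Empty
DepthPos (lnode _ _) = ⊤

CompleteOfDepth : ℕ → Tree → Set
CompleteOfDepth zero    leaf       = ⊤
CompleteOfDepth zero    (node _ _) = Data.Empty.⊥ where import Data.Empty
CompleteOfDepth (suc d) leaf       = Data.Empty.⊥ where import Data.Empty
CompleteOfDepth (suc d) (node l r) = CompleteOfDepth d l × CompleteOfDepth d r

data HasLeaf (b : Bool) : LTree → Set where
  here  : HasLeaf b (lleaf b)
  left  : ∀ {l r} → HasLeaf b l → HasLeaf b (lnode l r)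
  right : ∀ {l r} → HasLeaf b r → HasLeaf b (lnode l r)

-- every (rooted, i.e. node-induced) subtree with more than one leaf
-- (equivalently: every subtree rooted at an internal node) has both a
-- 0-leaf and a 1-leaf
Balanced : LTree → Set
Balanced (lleaf _)   = ⊤
Balanced (lnode l r) =
  (HasLeaf false (lnode l r) × HasLeaf true (lnode l r)) × (Balanced l × Balanced r)

{-# OPTIONS --safe #-}
module Submission where

open import Defs
open import Data.Nat using (ℕ; zero; suc; _+_; _∸_; _⊔_; _≤_; _≥_; _≟_; s≤s; z≤n)
open import Data.Nat.Properties
open import Data.Bool using (true; false)
open import Data.Product using (_×_; _,_; ∃-syntax)
open import Data.Empty using (⊥-elim)
open import Relation.Nullary using (yes; no)
open import Relation.Binary.Definitions using (tri<; tri≈; tri>)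
open import Relation.Binary.PropositionalEquality using (_≡_; _≢_; refl; sym; trans; cong; cong₂; module ≡-Reasoning)

-- The rank combination commutes with adding a constant to both children, so
-- attaching trees of equal rank r₀ below a complete tree adds r₀ everywhere, and
-- in general attaching T₀, T₁ adds at most max(r₀,r₁).  For the lower bound, an
-- internal node of a balanced T whose children are leaves carries both labels,
-- so it becomes a node over T₀ and T₁, of rank at least max(r₀,r₁) = its old
-- rank plus max(r₀,r₁) − 1.  Going up, a node with a leaf child just inherits
-- both ranks from its other child, and at a node with two internal children the
-- deficit "− 1" commutes with the rank combination.  If T is complete and
-- r₀ ≠ r₁, every bound in this induction is attained.

rankNode-comm : ∀ a b → rankNode a b ≡ rankNode b a
rankNode-comm a b with a ≟ b | b ≟ a
... | yes refl | yes _ = refl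
... | yes p    | no ¬q = ⊥-elim (¬q (sym p))
... | no ¬p    | yes q = ⊥-elim (¬p (sym q))
... | no _     | no _  = ⊔-comm a b

rankNode-+ : ∀ a b k → rankNode (a + k) (b + k) ≡ rankNode a b + k
rankNode-+ a b k with a ≟ b | a + k ≟ b + k
... | yes _ | yes _  = refl
... | yes p | no ¬q  = ⊥-elim (¬q (cong (_+ k) p))
... | no ¬p | yes q  = ⊥-elim (¬p (+-cancelʳ-≡ k a b q))
... | no _  | no _   = sym (+-distribʳ-⊔ k a b)

rankNode-suc : ∀ a b → rankNode (suc a) (suc b) ≡ suc (rankNode a b)
rankNode-suc a b with a ≟ b | suc a ≟ suc b
... | yes _ | yes _ = refl
... | yes p | no ¬q = ⊥-elim (¬q (cong suc p))
... | no ¬p | yes q = ⊥-elim (¬p (suc-injective q))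
... | no _  | no _  = refl

rankNode-≢ : ∀ {a b} → a ≢ b → rankNode a b ≡ a ⊔ b
rankNode-≢ {a} {b} a≢b with a ≟ b
... | yes a≡b = ⊥-elim (a≢b a≡b)
... | no _    = refl

⊔≤rankNode : ∀ a b → a ⊔ b ≤ rankNode a b
⊔≤rankNode a b with a ≟ b
... | yes refl = ≤-trans (≤-reflexive (⊔-idem a)) (n≤1+n a)
... | no _     = ≤-refl

≤rankNodeˡ : ∀ a b → a ≤ rankNode a b
≤rankNodeˡ a b = ≤-trans (m≤m⊔n a b) (⊔≤rankNode a b)

≤rankNodeʳ : ∀ a b → b ≤ rankNode a b
≤rankNodeʳ a b = ≤-trans (m≤n⊔m a b) (⊔≤rankNode a b)

rankNode-mono-≤ : ∀ {a b a′ b′} → a ≤ a′ → b ≤ b′ → rankNode a b ≤ rankNode a′ b′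
rankNode-mono-≤ {a} {b} {a′} {b′} a≤a′ b≤b′ with a ≟ b | a′ ≟ b′
... | yes _    | yes _ = s≤s a≤a′
... | no _     | no _  = ⊔-mono-≤ a≤a′ b≤b′
... | no _     | yes refl = ⊔-lub (≤-trans a≤a′ (n≤1+n a′)) (≤-trans b≤b′ (n≤1+n a′))
... | yes refl | no a′≢b′ with <-cmp a′ b′
...   | tri< a′<b′ _ _ = ≤-trans (≤-trans (s≤s a≤a′) a′<b′) (m≤n⊔m a′ b′)
...   | tri≈ _ a′≡b′ _ = ⊥-elim (a′≢b′ a′≡b′)
...   | tri> _ _ a′>b′ = ≤-trans (≤-trans (s≤s b≤b′) a′>b′) (m≤m⊔n a′ b′)

1≤rankNode : ∀ a b → 1 ≤ rankNode a b
1≤rankNode a b with a ≟ b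
... | yes _ = s≤s z≤n
1≤rankNode zero    zero    | no 0≢0 = ⊥-elim (0≢0 refl)
1≤rankNode zero    (suc b) | no _   = s≤s z≤n
1≤rankNode (suc a) b       | no _   = ≤-trans (s≤s z≤n) (m≤m⊔n (suc a) b)

rankNode-identityʳ : ∀ {a} → 1 ≤ a → rankNode a 0 ≡ a
rankNode-identityʳ {suc a} _ = refl

rankNode-identityˡ : ∀ {a} → 1 ≤ a → rankNode 0 a ≡ a
rankNode-identityˡ {suc a} _ = refl

module Attach (T₀ T₁ : Tree) where

  r₀ r₁ m : ℕ
  r₀ = rank T₀
  r₁ = rank T₁
  m  = r₀ ⊔ r₁

  A : LTree → Tree
  A T = attach T T₀ T₁

  rank-attach-≤ : ∀ T → rank (A T) ≤ lrank T + m
  rank-attach-≤ (lleaf false) = m≤m⊔n r₀ r₁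
  rank-attach-≤ (lleaf true)  = m≤n⊔m r₀ r₁
  rank-attach-≤ (lnode l r)   = begin
    rankNode (rank (A l)) (rank (A r))       ≤⟨ rankNode-mono-≤ (rank-attach-≤ l) (rank-attach-≤ r) ⟩
    rankNode (lrank l + m) (lrank r + m)     ≡⟨ rankNode-+ (lrank l) (lrank r) m ⟩
    lrank (lnode l r) + m                    ∎
    where open ≤-Reasoning

  rank-attach-complete : ∀ d T → CompleteOfDepth d (unlabel T) → r₀ ≡ r₁ →
                         rank (A T) ≡ lrank T + r₀
  rank-attach-complete zero    (lleaf false) _         _       = refl
  rank-attach-complete zero    (lleaf true)  _         r₀≡r₁   = sym r₀≡r₁
  rank-attach-complete (suc d) (lnode l r)   (cl , cr) r₀≡r₁   =
    trans (cong₂ rankNode (rank-attach-complete d l cl r₀≡r₁) (rank-attach-complete d r cr r₀≡r₁))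
          (rankNode-+ (lrank l) (lrank r) r₀)

  rank-attach-balanced-cherry : ∀ {b c} → Balanced (lnode (lleaf b) (lleaf c)) →
                                rank (A (lnode (lleaf b) (lleaf c))) ≡ rankNode r₀ r₁
  rank-attach-balanced-cherry {false} {true}  _ = refl
  rank-attach-balanced-cherry {true}  {false} _ = rankNode-comm r₁ r₀
  rank-attach-balanced-cherry {false} {false} ((_ , left ()) , _)
  rank-attach-balanced-cherry {false} {false} ((_ , right ()) , _)
  rank-attach-balanced-cherry {true}  {true}  ((left () , _) , _)
  rank-attach-balanced-cherry {true}  {true}  ((right () , _) , _)

  rank-attach-≥ : ∀ l r → Balanced (lnode l r) → lrank (lnode l r) + m ≤ suc (rank (A (lnode l r)))
  rank-attach-≥ (lleaf b) (lleaf c) bal =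
    s≤s (≤-trans (⊔≤rankNode r₀ r₁) (≤-reflexive (sym (rank-attach-balanced-cherry bal))))
  rank-attach-≥ (lnode a b) (lleaf c) (_ , bal , _) = begin
    rankNode (lrank (lnode a b)) 0 + m   ≡⟨ cong (_+ m) (rankNode-identityʳ (1≤rankNode (lrank a) (lrank b))) ⟩
    lrank (lnode a b) + m                ≤⟨ rank-attach-≥ a b bal ⟩
    suc (rank (A (lnode a b)))           ≤⟨ s≤s (≤rankNodeˡ _ (rank (A (lleaf c)))) ⟩
    suc (rank (A (lnode (lnode a b) (lleaf c)))) ∎
    where open ≤-Reasoning
  rank-attach-≥ (lleaf c) (lnode a b) (_ , _ , bal) = begin
    rankNode 0 (lrank (lnode a b)) + m   ≡⟨ cong (_+ m) (rankNode-identityˡ (1≤rankNode (lrank a) (lrank b))) ⟩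
    lrank (lnode a b) + m                ≤⟨ rank-attach-≥ a b bal ⟩
    suc (rank (A (lnode a b)))           ≤⟨ s≤s (≤rankNodeʳ (rank (A (lleaf c))) _) ⟩
    suc (rank (A (lnode (lleaf c) (lnode a b)))) ∎
    where open ≤-Reasoning
  rank-attach-≥ (lnode a b) (lnode c d) (_ , balₗ , balᵣ) = begin
    rankNode (lrank (lnode a b)) (lrank (lnode c d)) + m
      ≡⟨ rankNode-+ (lrank (lnode a b)) (lrank (lnode c d)) m ⟨
    rankNode (lrank (lnode a b) + m) (lrank (lnode c d) + m)
      ≤⟨ rankNode-mono-≤ (rank-attach-≥ a b balₗ) (rank-attach-≥ c d balᵣ) ⟩
    rankNode (suc (rank (A (lnode a b)))) (suc (rank (A (lnode c d))))
      ≡⟨ rankNode-suc (rank (A (lnode a b))) (rank (A (lnode c d))) ⟩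
    suc (rank (A (lnode (lnode a b) (lnode c d)))) ∎
    where open ≤-Reasoning

  rank-attach-complete-balanced : ∀ d T → CompleteOfDepth (suc d) (unlabel T) → Balanced T →
                                  r₀ ≢ r₁ → suc (rank (A T)) ≡ lrank T + m
  rank-attach-complete-balanced zero (lnode (lleaf b) (lleaf c)) _ bal r₀≢r₁ =
    cong suc (trans (rank-attach-balanced-cherry bal) (rankNode-≢ r₀≢r₁))
  rank-attach-complete-balanced (suc d) (lnode l r) (cl , cr) (_ , balₗ , balᵣ) r₀≢r₁ = begin
    suc (rankNode (rank (A l)) (rank (A r)))
      ≡⟨ rankNode-suc (rank (A l)) (rank (A r)) ⟨
    rankNode (suc (rank (A l))) (suc (rank (A r)))
      ≡⟨ cong₂ rankNode (rank-attach-complete-balanced d l cl balₗ r₀≢r₁)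
                        (rank-attach-complete-balanced d r cr balᵣ r₀≢r₁) ⟩
    rankNode (lrank l + m) (lrank r + m)
      ≡⟨ rankNode-+ (lrank l) (lrank r) m ⟩
    lrank (lnode l r) + m ∎
    where open ≡-Reasoning

open Attach

proposition4p2 : (T : LTree) → DepthPos T → (T₀ T₁ : Tree) →
    ((rank (attach T T₀ T₁) ≤ lrank T + (rank T₀ ⊔ rank T₁))
    × ((∃[ d ] CompleteOfDepth d (unlabel T)) → rank T₀ ≡ rank T₁ →
    rank (attach T T₀ T₁) ≡ lrank T + rank T₀))
    × (Balanced T →
    ((rank (attach T T₀ T₁) ≥ (lrank T + (rank T₀ ⊔ rank T₁)) ∸ 1)
    × ((∃[ d ] CompleteOfDepth d (unlabel T)) → rank T₀ ≢ rank T₁ →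
    rank (attach T T₀ T₁) ≡ (lrank T + (rank T₀ ⊔ rank T₁)) ∸ 1)))
proposition4p2 (lnode l r) _ T₀ T₁ =
    ( rank-attach-≤ T₀ T₁ T
    , λ { (d , complete) r₀≡r₁ → rank-attach-complete T₀ T₁ d T complete r₀≡r₁ } )
  , λ balanced →
      ( ∸-monoˡ-≤ 1 (rank-attach-≥ T₀ T₁ l r balanced)
      , λ { (suc d , complete) r₀≢r₁ →
              cong (_∸ 1) (rank-attach-complete-balanced T₀ T₁ d T complete balanced r₀≢r₁) } )
  where T = lnode l r
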